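{- Let $T$ be an increasing shifted skew tableau of shape $\lambda/\mu$ with entries in $[q]$, with the boxes of $\mu$ filled by $\underline 1,\ldots,\underline p$ in superstandard order ($p=|\mu|$). Applying the switches of any viable switch sequence, in order, to this filling yields the same superstandard $K$-rectification of $T$ as applying the standard switch sequence.
   Context: Shifted shape of a strict partition $\lambda$: boxes $(i,j)$, $i\le j\le i+\lambda_i-1$. For strict partitions $\mu\subseteq\lambda$, the skew shape $\lambda/\mu$ consists of boxes of $\lambda$ not in $\mu$. An increasing shifted skew tableau is a filling of $\lambda/\mu$ by positive integers strictly increasing along rows and down columns. The superstandard filling of $\mu$ places $\underline 1,\ldots,\underline{\mu_1}$ in the first row left to right, the next underlined symbols in the second row, and so on. Two boxes are adjacent if they share an edge. The switch $(\underline i,j)$ (for $1\le i\le p$, $1\le j\le q$) simultaneously relabels every box labeled $\underline i$ adjacent to a box labeled $j$ by $j$, and every box labeled $j$ adjacent to a box labeled $\underline i$ by $\underline i$; other boxes are unchanged. The standard switch sequence is $(\underline p,1),\ldots,(\underline p,q),(\underline{p-1},1),\ldots,(\underline{p-1},q),\ldots,(\underline 1,1),\ldots,(\underline 1,q)$, applied left to right; the non-underlined entries of the result form an increasing shifted tableau of straight shape, the superstandard $K$-rectification of $T$. A viable switch sequence is a sequence of switches in which every $(\underline i,j)$, $1\le i\le p$, $1\le j\le q$, occurs exactly once; for each $i$, $(\underline i,1),\ldots,(\underline i,q)$ occur in that relative order; and for each $j$, $(\underline p,j),\ldots,(\underline 1,j)$ occur in that relative order. -}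

module Defs where

open import Data.Nat using (ℕ; zero; suc; _+_; _∸_; _≤_; _<_; _≤ᵇ_; _<ᵇ_; _≡ᵇ_)
open import Data.Bool using (Bool; true; false; _∧_; if_then_else_)
open import Data.List using (List; []; _∷_; _++_; take; map; concatMap; upTo; downFrom; foldl; length)
open import Data.Nat.ListAction using (sum)
open import Data.Bool.ListAction using (any)
open import Data.List.Membership.Propositional using (_∈_)
open import Data.List.Relation.Unary.All using (All)
open import Data.List.Relation.Unary.Linked using (Linked)
open import Data.List.Relation.Binary.Permutation.Propositional using (_↭_)
open import Data.Product using (_×_; _,_; ∃-syntax)
open import Data.Maybe using (Maybe; just; nothing)
open import Relation.Binary.PropositionalEquality using (_≡_)

StrictPartition : List ℕ → Set
StrictPartition λs = All (0 <_) λs × Linked (λ a b → b < a) λs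

part : List ℕ → ℕ → ℕ
part []       _       = 0
part (x ∷ xs) zero    = x
part (x ∷ xs) (suc i) = part xs i

_⊆ₚ_ : List ℕ → List ℕ → Set
μ ⊆ₚ λs = ∀ i → part μ i ≤ part λs i

-- Shifted shape, 0-indexed rows/columns: box (a , b) lies in row a iff
-- a ≤ b < a + λ_a   (the paper's i ≤ j ≤ i + λ_i - 1 with 1-indexing).
InShape : List ℕ → ℕ → ℕ → Set
InShape λs a b = a ≤ b × b < a + part λs a

inShape : List ℕ → ℕ → ℕ → Bool
inShape λs a b = (a ≤ᵇ b) ∧ (b <ᵇ a + part λs a)

InSkew : List ℕ → List ℕ → ℕ → ℕ → Set
InSkew λs μ a b = InShape λs a b × (InShape μ a b → Data.Empty.⊥)
  where import Data.Empty

-- Increasing shifted skew tableau of shape λ/μ with entries in [q]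
-- (T is only meaningful on boxes of λ/μ)

IncreasingSkewTableau : List ℕ → List ℕ → ℕ → (ℕ → ℕ → ℕ) → Set
IncreasingSkewTableau λs μ q T =
    (∀ a b → InSkew λs μ a b → 1 ≤ T a b × T a b ≤ q)
  × (∀ a b b' → InSkew λs μ a b → InSkew λs μ a b' → b < b' → T a b < T a b')
  × (∀ a a' b → InSkew λs μ a b → InSkew λs μ a' b → a < a' → T a b < T a' b)

-- Labels: underlined  ul i  or plain  pl j

data Label : Set where
  ul : ℕ → Label
  pl : ℕ → Label

_==ᴸ_ : Label → Label → Bool
ul i ==ᴸ ul j = i ≡ᵇ j
pl i ==ᴸ pl j = i ≡ᵇ j
_    ==ᴸ _    = false

Filling : Set
Filling = ℕ → ℕ → Label

-- Initial filling: superstandard filling of μ, and T on λ/μ.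
-- Box (a , b) of μ gets  ul (μ_0 + … + μ_{a-1} + (b - a) + 1).
initialFilling : List ℕ → (ℕ → ℕ → ℕ) → Filling
initialFilling μ T a b =
  if inShape μ a b then ul (sum (take a μ) + (b ∸ a) + 1) else pl (T a b)

neighbours : ℕ → ℕ → List (ℕ × ℕ)
neighbours a b = (suc a , b) ∷ (a , suc b) ∷ up a ++ left b
  where
  up : ℕ → List (ℕ × ℕ)
  up zero    = []
  up (suc c) = (c , b) ∷ []
  left : ℕ → List (ℕ × ℕ)
  left zero    = []
  left (suc d) = (a , d) ∷ []

hasNeighbour : List ℕ → Filling → ℕ → ℕ → Label → Bool
hasNeighbour λs F a b ℓ =
  any (λ { (c , d) → inShape λs c d ∧ (F c d ==ᴸ ℓ) }) (neighbours a b)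

switch : List ℕ → ℕ × ℕ → Filling → Filling
switch λs (i , j) F a b =
  if inShape λs a b
  then (if (F a b ==ᴸ ul i) ∧ hasNeighbour λs F a b (pl j) then pl j
        else if (F a b ==ᴸ pl j) ∧ hasNeighbour λs F a b (ul i) then ul i
        else F a b)
  else F a b

applySwitches : List ℕ → List (ℕ × ℕ) → Filling → Filling
applySwitches λs s F = foldl (λ G ij → switch λs ij G) F s

-- Standard switch sequence (p,1)…(p,q),(p-1,1)…,…,(1,1)…(1,q)
standardSeq : ℕ → ℕ → List (ℕ × ℕ)
standardSeq p q =
  concatMap (λ i → map (λ j → (i , j)) (map suc (upTo q))) (map suc (downFrom p))

Before : ℕ × ℕ → ℕ × ℕ → List (ℕ × ℕ) → Set
Before x y s = ∃[ pre ] ∃[ suf ] (s ≡ pre ++ x ∷ suf × y ∈ suf)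

Viable : ℕ → ℕ → List (ℕ × ℕ) → Set
Viable p q s =
    (s ↭ standardSeq p q)   -- every (i , j), 1≤i≤p, 1≤j≤q, exactly once
  × (∀ i j j' → 1 ≤ i → i ≤ p → 1 ≤ j → j < j' → j' ≤ q → Before (i , j) (i , j') s)
  × (∀ j i i' → 1 ≤ j → j ≤ q → 1 ≤ i → i < i' → i' ≤ p → Before (i' , j) (i , j) s)

plainPart : Filling → ℕ → ℕ → Maybe ℕ
plainPart F a b with F a b
... | pl j = just j
... | ul _ = nothing

-- Switches (i , j) and (i' , j') with i ≢ i' and j ≢ j' act on disjoint sets of labels,
-- and the neighbour tests of each only look for labels that the other never creates or
-- destroys; hence they commute as operations on fillings. A viable sequence is a
-- permutation of the standard one that keeps the relative order of any two switches
-- sharing an index. Moving the next switch of the standard sequence to the front of the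
-- viable one, past switches that all commute with it, turns one sequence into the other.
-- No property of the shapes or of the tableau is needed.
module Submission where

open import Defs
open import Data.Bool using (Bool; true; false; _∧_; if_then_else_)
open import Data.Bool.ListAction using (or)
open import Data.Empty using (⊥-elim)
open import Data.List using (List; []; _∷_; _++_; map; upTo)
open import Data.List.Membership.Propositional using (_∈_)
open import Data.List.Membership.Propositional.Properties
  using (∈-++⁺ˡ; ∈-++⁺ʳ; ∈-++⁻; ∈-∃++; ∈-map⁺; ∈-map⁻; ∈-upTo⁺; ∈-upTo⁻)
open import Data.List.Properties using (foldl-++; upTo-∷ʳ; map-++; map-cong; ++-assoc)
open import Data.List.Relation.Binary.Disjoint.Propositional using (Disjoint)
open import Data.List.Relation.Binary.Permutation.Propositional
  using (_↭_; ↭-sym; ↭⇒↭ₛ)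
open import Data.List.Relation.Binary.Permutation.Propositional.Properties
  using (↭-empty-inv; ∈-resp-↭; drop-mid)
import Data.List.Relation.Binary.Permutation.Setoid.Properties as Permutationₛ
open import Data.List.Relation.Unary.All as All using (All)
open import Data.List.Relation.Unary.Any using (here; there)
open import Data.List.Relation.Unary.Unique.Propositional using (Unique; []; _∷_)
import Data.List.Relation.Unary.Unique.Propositional.Properties as Unique
open import Data.Nat using (ℕ; zero; suc; _≤_; _<_; _≟_; s≤s; z≤n)
open import Data.Nat.ListAction using (sum)
open import Data.Nat.Properties
  using (<-cmp; <-irrefl; ≤-refl; ≤-pred; suc-injective; m≤n⇒m≤1+n; m<1+n⇒m<n∨m≡n; m≤n⇒m<n∨m≡n)
open import Data.Product using (_×_; _,_; proj₁; proj₂; ∃-syntax)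
open import Data.Sum using (_⊎_; inj₁; inj₂)
open import Function using (_∘_)
open import Relation.Binary using (tri<; tri≈; tri>)
open import Relation.Binary.PropositionalEquality
open import Relation.Binary.PropositionalEquality.Properties using (setoid)
open import Relation.Nullary using (¬_; Dec; yes; no)
open import Relation.Nullary.Decidable using (dec-true; dec-false)

==ᴸ-refl : ∀ ℓ → (ℓ ==ᴸ ℓ) ≡ true
==ᴸ-refl (ul m) = dec-true (m ≟ m) refl
==ᴸ-refl (pl m) = dec-true (m ≟ m) refl

==ᴸ-≢ : ∀ {ℓ ℓ'} → ℓ ≢ ℓ' → (ℓ ==ᴸ ℓ') ≡ false
==ᴸ-≢ {ul m} {ul n} ℓ≢ℓ' = dec-false (m ≟ n) (ℓ≢ℓ' ∘ cong ul)
==ᴸ-≢ {ul m} {pl n} _    = refl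
==ᴸ-≢ {pl m} {ul n} _    = refl
==ᴸ-≢ {pl m} {pl n} ℓ≢ℓ' = dec-false (m ≟ n) (ℓ≢ℓ' ∘ cong pl)

Switch : Set
Switch = ℕ × ℕ

Involves : Switch → Label → Set
Involves (i , j) (ul k) = k ≡ i
Involves (i , j) (pl k) = k ≡ j

involves? : ∀ x ℓ → Dec (Involves x ℓ)
involves? (i , j) (ul k) = k ≟ i
involves? (i , j) (pl k) = k ≟ j

Independent : Switch → Switch → Set
Independent (i , j) (i' , j') = i ≢ i' × j ≢ j'

Dependent : Switch → Switch → Set
Dependent (i , j) (i' , j') = i ≡ i' ⊎ j ≡ j'

independent-sym : ∀ {x y} → Independent x y → Independent y x
independent-sym {_ , _} {_ , _} (i≢i' , j≢j') = ≢-sym i≢i' , ≢-sym j≢j'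

independent⊎dependent : ∀ x y → Independent x y ⊎ Dependent x y
independent⊎dependent (i , j) (i' , j') with i ≟ i' | j ≟ j'
... | yes i≡i' | _        = inj₂ (inj₁ i≡i')
... | no _     | yes j≡j' = inj₂ (inj₂ j≡j')
... | no i≢i'  | no j≢j'  = inj₁ (i≢i' , j≢j')

involves-exclusive : ∀ {x y ℓ} → Independent x y → Involves x ℓ → ¬ Involves y ℓ
involves-exclusive {_ , _} {_ , _} {ul _} (i≢i' , _) refl = i≢i'
involves-exclusive {_ , _} {_ , _} {pl _} (_ , j≢j') refl = j≢j'

-- switch λs (i , j) F a b unfolds to switchLabel (inShape λs a b) (i , j) (F a b) nearPl nearUl,
-- where nearPl / nearUl test whether the box has a neighbour labelled pl j / ul i.
switchLabel : Bool → Switch → Label → Bool → Bool → Label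
switchLabel inside (i , j) ℓ nearPl nearUl =
  if inside
  then (if (ℓ ==ᴸ ul i) ∧ nearPl then pl j
        else if (ℓ ==ᴸ pl j) ∧ nearUl then ul i
        else ℓ)
  else ℓ

switchLabel-fixes : ∀ inside x ℓ u v → ¬ Involves x ℓ → switchLabel inside x ℓ u v ≡ ℓ
switchLabel-fixes false _ _ _ _ _ = refl
switchLabel-fixes true (i , j) (ul k) u v k≢i
  rewrite ==ᴸ-≢ {ul k} {ul i} (λ { refl → k≢i refl }) = refl
switchLabel-fixes true (i , j) (pl k) u v k≢j
  rewrite ==ᴸ-≢ {pl k} {pl j} (λ { refl → k≢j refl }) = refl

switchLabel-involves : ∀ inside x ℓ u v →
  Involves x ℓ → Involves x (switchLabel inside x ℓ u v)
switchLabel-involves false _ _ _ _ xℓ = xℓ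
switchLabel-involves true (i , j) (ul i) u v refl rewrite ==ᴸ-refl (ul i) with u
... | true  = refl
... | false = refl
switchLabel-involves true (i , j) (pl j) u v refl rewrite ==ᴸ-refl (pl j) with v
... | true  = refl
... | false = refl

switchLabel-comm-fixed : ∀ inside x y ℓ u v u' v' →
  ¬ Involves y ℓ → ¬ Involves y (switchLabel inside x ℓ u v) →
  switchLabel inside x (switchLabel inside y ℓ u' v') u v
    ≡ switchLabel inside y (switchLabel inside x ℓ u v) u' v'
switchLabel-comm-fixed inside x y ℓ u v u' v' ¬yℓ ¬yxℓ =
  trans (cong (λ ℓ → switchLabel inside x ℓ u v) (switchLabel-fixes inside y ℓ u' v' ¬yℓ))
        (sym (switchLabel-fixes inside y (switchLabel inside x ℓ u v) u' v' ¬yxℓ))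

switchLabel-comm : ∀ inside x y ℓ u v u' v' → Independent x y →
  switchLabel inside x (switchLabel inside y ℓ u' v') u v
    ≡ switchLabel inside y (switchLabel inside x ℓ u v) u' v'
switchLabel-comm inside x y ℓ u v u' v' x⊥y with involves? x ℓ | involves? y ℓ
... | yes xℓ | _ = switchLabel-comm-fixed inside x y ℓ u v u' v'
  (involves-exclusive x⊥y xℓ)
  (involves-exclusive x⊥y (switchLabel-involves inside x ℓ u v xℓ))
... | no _ | yes yℓ = sym (switchLabel-comm-fixed inside y x ℓ u' v' u v
  (involves-exclusive (independent-sym x⊥y) yℓ)
  (involves-exclusive (independent-sym x⊥y) (switchLabel-involves inside y ℓ u' v' yℓ)))
... | no ¬xℓ | no ¬yℓ = switchLabel-comm-fixed inside x y ℓ u v u' v'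
  ¬yℓ (subst (¬_ ∘ Involves y) (sym (switchLabel-fixes inside x ℓ u v ¬xℓ)) ¬yℓ)

==ᴸ-involved : ∀ {x y} ℓ ℓ' → Independent x y → Involves x ℓ → Involves y ℓ' →
  (ℓ' ==ᴸ ℓ) ≡ false
==ᴸ-involved ℓ ℓ' x⊥y xℓ yℓ' = ==ᴸ-≢ {ℓ'} {ℓ} λ { refl → involves-exclusive x⊥y xℓ yℓ' }

switchLabel-preserves-==ᴸ : ∀ inside {x} y ℓ ℓ' u v → Independent x y → Involves x ℓ →
  (switchLabel inside y ℓ' u v ==ᴸ ℓ) ≡ (ℓ' ==ᴸ ℓ)
switchLabel-preserves-==ᴸ inside y ℓ ℓ' u v x⊥y xℓ with involves? y ℓ'
... | no ¬yℓ' = cong (_==ᴸ ℓ) (switchLabel-fixes inside y ℓ' u v ¬yℓ')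
... | yes yℓ' = trans
  (==ᴸ-involved ℓ _ x⊥y xℓ (switchLabel-involves inside y ℓ' u v yℓ'))
  (sym (==ᴸ-involved ℓ ℓ' x⊥y xℓ yℓ'))

-- Defs.Before for an arbitrary element type: Before x y s is Precedes x y s by definition.
Precedes : {A : Set} → A → A → List A → Set
Precedes x y s = ∃[ pre ] ∃[ suf ] (s ≡ pre ++ x ∷ suf × y ∈ suf)

module _ {A : Set} where

  precedes-head : ∀ {x y : A} {s} → y ∈ s → Precedes x y (x ∷ s)
  precedes-head y∈s = [] , _ , refl , y∈s

  precedes-∷ : ∀ {x y z : A} {s} → Precedes x y s → Precedes x y (z ∷ s)
  precedes-∷ (pre , suf , refl , y∈suf) = _ ∷ pre , suf , refl , y∈suf

  precedes-uncons : ∀ {x y z : A} {s} →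
    Precedes x y (z ∷ s) → (x ≡ z × y ∈ s) ⊎ Precedes x y s
  precedes-uncons ([]      , suf , refl , y∈suf) = inj₁ (refl , y∈suf)
  precedes-uncons (_ ∷ pre , suf , refl , y∈suf) = inj₂ (pre , suf , refl , y∈suf)

  precedes-∈ˡ : ∀ {x y : A} {s} → Precedes x y s → x ∈ s
  precedes-∈ˡ (pre , _ , refl , _) = ∈-++⁺ʳ pre (here refl)

  precedes-∈ʳ : ∀ {x y : A} {s} → Precedes x y s → y ∈ s
  precedes-∈ʳ (pre , _ , refl , y∈suf) = ∈-++⁺ʳ pre (there y∈suf)

  precedes-++ˡ : ∀ {x y : A} pre {s} → Precedes x y s → Precedes x y (pre ++ s)
  precedes-++ˡ []        x≺y = x≺y
  precedes-++ˡ (_ ∷ pre) x≺y = precedes-∷ (precedes-++ˡ pre x≺y)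

  precedes-++ʳ : ∀ {x y : A} {s} t → Precedes x y s → Precedes x y (s ++ t)
  precedes-++ʳ {x} t (pre , suf , refl , y∈suf) =
    pre , suf ++ t , ++-assoc pre (x ∷ suf) t , ∈-++⁺ˡ y∈suf

  precedes-++ : ∀ {x y : A} {s t} → x ∈ s → y ∈ t → Precedes x y (s ++ t)
  precedes-++ {s = _ ∷ s} (here refl) y∈t = precedes-head (∈-++⁺ʳ s y∈t)
  precedes-++ (there x∈s) y∈t = precedes-∷ (precedes-++ x∈s y∈t)

  precedes-map : ∀ {B : Set} (f : A → B) {x y s} →
    Precedes x y s → Precedes (f x) (f y) (map f s)
  precedes-map f {x} (pre , suf , refl , y∈suf) =
    map f pre , map f suf , map-++ f pre (x ∷ suf) , ∈-map⁺ f y∈suf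

  precedes-asym : ∀ {x y : A} {s} → Unique s → Precedes x y s → ¬ Precedes y x s
  precedes-asym [] x≺y with () ← precedes-∈ˡ x≺y
  precedes-asym (z∉s ∷ uniq) x≺y y≺x with precedes-uncons x≺y | precedes-uncons y≺x
  ... | inj₁ (refl , y∈s) | inj₁ (refl , _) = All.lookup z∉s y∈s refl
  ... | inj₁ (refl , _)   | inj₂ y≺x'       = All.lookup z∉s (precedes-∈ʳ y≺x') refl
  ... | inj₂ x≺y'         | inj₁ (refl , _) = All.lookup z∉s (precedes-∈ʳ x≺y') refl
  ... | inj₂ x≺y'         | inj₂ y≺x'       = precedes-asym uniq x≺y' y≺x'

  precedes-irrefl : ∀ {x : A} {s} → Unique s → ¬ Precedes x x s
  precedes-irrefl uniq x≺x = precedes-asym uniq x≺x x≺x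

  ∈-drop-mid : ∀ {y z : A} pre {suf} → y ∈ pre ++ z ∷ suf → y ≢ z → y ∈ pre ++ suf
  ∈-drop-mid []        (here y≡z)  y≢z = ⊥-elim (y≢z y≡z)
  ∈-drop-mid []        (there y∈)  _   = y∈
  ∈-drop-mid (_ ∷ pre) (here y≡w)  _   = here y≡w
  ∈-drop-mid (_ ∷ pre) (there y∈)  y≢z = there (∈-drop-mid pre y∈ y≢z)

  precedes-drop-mid : ∀ {x y z : A} pre {suf} →
    Precedes x y (pre ++ z ∷ suf) → x ≢ z → y ≢ z → Precedes x y (pre ++ suf)
  precedes-drop-mid [] x≺y x≢z _ with precedes-uncons x≺y
  ... | inj₁ (x≡z , _) = ⊥-elim (x≢z x≡z)
  ... | inj₂ x≺y'      = x≺y'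
  precedes-drop-mid (_ ∷ pre) x≺y x≢z y≢z with precedes-uncons x≺y
  ... | inj₁ (refl , y∈) = precedes-head (∈-drop-mid pre y∈ y≢z)
  ... | inj₂ x≺y'        = precedes-∷ (precedes-drop-mid pre x≺y' x≢z y≢z)

Unique-resp-↭ : {A : Set} {s t : List A} → s ↭ t → Unique s → Unique t
Unique-resp-↭ {A} s↭t = Permutationₛ.Unique-resp-↭ (setoid A) (↭⇒↭ₛ s↭t)

RespectsDependentOrder : List Switch → List Switch → Set
RespectsDependentOrder t s = ∀ x y → Dependent x y → Precedes x y t → Precedes x y s

infix 4 _≋_

_≋_ : Filling → Filling → Set
F ≋ G = ∀ a b → F a b ≡ G a b

≋-refl : ∀ {F} → F ≋ F
≋-refl _ _ = refl

≋-sym : ∀ {F G} → F ≋ G → G ≋ F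
≋-sym F≋G a b = sym (F≋G a b)

≋-trans : ∀ {F G H} → F ≋ G → G ≋ H → F ≋ H
≋-trans F≋G G≋H a b = trans (F≋G a b) (G≋H a b)

plainPart-cong : ∀ {F G} → F ≋ G → ∀ a b → plainPart F a b ≡ plainPart G a b
plainPart-cong {F} {G} F≋G a b with F a b | G a b | F≋G a b
... | ul _ | _ | refl = refl
... | pl _ | _ | refl = refl

module _ (λs : List ℕ) where

  hasNeighbour-cong : ∀ F G ℓ → (∀ c d → (F c d ==ᴸ ℓ) ≡ (G c d ==ᴸ ℓ)) →
    ∀ a b → hasNeighbour λs F a b ℓ ≡ hasNeighbour λs G a b ℓ
  hasNeighbour-cong F G ℓ F≈G a b =
    cong or (map-cong (λ { (c , d) → cong (inShape λs c d ∧_) (F≈G c d) }) (neighbours a b))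

  switch-cong : ∀ x {F G} → F ≋ G → switch λs x F ≋ switch λs x G
  switch-cong (i , j) {F} {G} F≋G a b = trans
    (cong (λ ℓ → switchLabel (inShape λs a b) (i , j) ℓ _ _) (F≋G a b))
    (cong₂ (switchLabel (inShape λs a b) (i , j) (G a b))
           (hasNeighbour-cong F G (pl j) (λ c d → cong (_==ᴸ pl j) (F≋G c d)) a b)
           (hasNeighbour-cong F G (ul i) (λ c d → cong (_==ᴸ ul i) (F≋G c d)) a b))

  switch-preserves-==ᴸ : ∀ {x} y F {ℓ} → Independent x y → Involves x ℓ →
    ∀ c d → (switch λs y F c d ==ᴸ ℓ) ≡ (F c d ==ᴸ ℓ)
  switch-preserves-==ᴸ (i' , j') F {ℓ} x⊥y xℓ c d = switchLabel-preserves-==ᴸ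
    (inShape λs c d) (i' , j') ℓ (F c d) _ _ x⊥y xℓ

  switch-comm : ∀ x y {F} → Independent x y →
    switch λs x (switch λs y F) ≋ switch λs y (switch λs x F)
  switch-comm (i , j) (i' , j') {F} x⊥y a b = begin
    switch λs (i , j) G a b
      ≡⟨ cong₂ (switchLabel inside (i , j) (G a b))
           (hasNeighbour-cong G F (pl j) (switch-preserves-==ᴸ (i' , j') F x⊥y refl) a b)
           (hasNeighbour-cong G F (ul i) (switch-preserves-==ᴸ (i' , j') F x⊥y refl) a b) ⟩
    switchLabel inside (i , j) (G a b) (near F (pl j)) (near F (ul i))
      ≡⟨ switchLabel-comm inside (i , j) (i' , j') (F a b) _ _ _ _ x⊥y ⟩
    switchLabel inside (i' , j') (H a b) (near F (pl j')) (near F (ul i'))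
      ≡⟨ sym (cong₂ (switchLabel inside (i' , j') (H a b))
           (hasNeighbour-cong H F (pl j') (switch-preserves-==ᴸ (i , j) F y⊥x refl) a b)
           (hasNeighbour-cong H F (ul i') (switch-preserves-==ᴸ (i , j) F y⊥x refl) a b)) ⟩
    switch λs (i' , j') H a b ∎
    where
    open ≡-Reasoning
    G = switch λs (i' , j') F
    H = switch λs (i , j) F
    inside = inShape λs a b
    near : Filling → Label → Bool
    near K = hasNeighbour λs K a b
    y⊥x = independent-sym {i , j} {i' , j'} x⊥y

  applySwitches-cong : ∀ s {F G} → F ≋ G → applySwitches λs s F ≋ applySwitches λs s G
  applySwitches-cong []      F≋G = F≋G
  applySwitches-cong (x ∷ s) F≋G = applySwitches-cong s (switch-cong x F≋G)

  applySwitches-++ : ∀ s t F →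
    applySwitches λs (s ++ t) F ≡ applySwitches λs t (applySwitches λs s F)
  applySwitches-++ s t F = foldl-++ (λ G x → switch λs x G) F s t

  applySwitches-switch-comm : ∀ {x} s {F} → All (Independent x) s →
    applySwitches λs s (switch λs x F) ≋ switch λs x (applySwitches λs s F)
  applySwitches-switch-comm []      All.[] = ≋-refl
  applySwitches-switch-comm {x} (y ∷ s) (x⊥y All.∷ x⊥s) = ≋-trans
    (applySwitches-cong s (switch-comm y x (independent-sym {x} {y} x⊥y)))
    (applySwitches-switch-comm s x⊥s)

  applySwitches-move-to-front : ∀ {x} pre suf F → All (Independent x) pre →
    applySwitches λs (pre ++ x ∷ suf) F ≋ applySwitches λs (x ∷ pre ++ suf) F
  applySwitches-move-to-front {x} pre suf F x⊥pre a b = begin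
    applySwitches λs (pre ++ x ∷ suf) F a b
      ≡⟨ cong (λ G → G a b) (applySwitches-++ pre (x ∷ suf) F) ⟩
    applySwitches λs suf (switch λs x (applySwitches λs pre F)) a b
      ≡⟨ applySwitches-cong suf (≋-sym (applySwitches-switch-comm pre x⊥pre)) a b ⟩
    applySwitches λs suf (applySwitches λs pre (switch λs x F)) a b
      ≡⟨ cong (λ G → G a b) (applySwitches-++ pre suf (switch λs x F)) ⟨
    applySwitches λs (pre ++ suf) (switch λs x F) a b ∎
    where open ≡-Reasoning

  applySwitches-reorder : ∀ {s t} → Unique t → s ↭ t → RespectsDependentOrder t s →
    ∀ F → applySwitches λs s F ≋ applySwitches λs t F
  applySwitches-reorder {t = []} _ s↭[] _ _ rewrite ↭-empty-inv s↭[] = ≋-refl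
  applySwitches-reorder {s} {x ∷ t} uniq@(_ ∷ uniq-t) s↭x∷t respects F
    with pre , suf , refl ← ∈-∃++ (∈-resp-↭ (↭-sym s↭x∷t) (here refl)) = ≋-trans
    (applySwitches-move-to-front pre suf F x⊥pre)
    (applySwitches-reorder uniq-t (drop-mid pre [] s↭x∷t) respects' (switch λs x F))
    where
    uniq-s : Unique s
    uniq-s = Unique-resp-↭ (↭-sym s↭x∷t) uniq

    x∉t : ¬ x ∈ t
    x∉t = Unique.Unique[x∷xs]⇒x∉xs uniq

    x≺y-if-dependent : ∀ {y} → y ∈ pre → Dependent x y → Precedes x y s
    x≺y-if-dependent y∈pre x~y with ∈-resp-↭ s↭x∷t (∈-++⁺ˡ y∈pre)
    ... | here refl = precedes-++ y∈pre (here refl)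
    ... | there y∈t = respects x _ x~y (precedes-head y∈t)

    x⊥pre : All (Independent x) pre
    x⊥pre = All.tabulate x⊥y-if-in-pre
      where
      x⊥y-if-in-pre : ∀ {y} → y ∈ pre → Independent x y
      x⊥y-if-in-pre {y} y∈pre with independent⊎dependent x y
      ... | inj₁ x⊥y = x⊥y
      ... | inj₂ x~y = ⊥-elim (precedes-asym uniq-s
        (x≺y-if-dependent y∈pre x~y) (precedes-++ y∈pre (here refl)))

    respects' : RespectsDependentOrder t (pre ++ suf)
    respects' u v u~v u≺v = precedes-drop-mid pre (respects u v u~v (precedes-∷ u≺v))
      (λ { refl → x∉t (precedes-∈ˡ u≺v) }) (λ { refl → x∉t (precedes-∈ʳ u≺v) })

row : ℕ → ℕ → List Switch
row i q = map (i ,_) (map suc (upTo q))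

∈-row⁻ : ∀ {i q i' j} → (i' , j) ∈ row i q → i' ≡ i × 1 ≤ j × j ≤ q
∈-row⁻ {i} ∈row
  with _ , k∈ , refl ← ∈-map⁻ (i ,_) ∈row
  with _ , l∈ , refl ← ∈-map⁻ suc k∈ = refl , s≤s z≤n , ∈-upTo⁻ l∈

∈-row⁺ : ∀ {i q j} → 1 ≤ j → j ≤ q → (i , j) ∈ row i q
∈-row⁺ {i} {j = suc k} _ j≤q = ∈-map⁺ (i ,_) (∈-map⁺ suc (∈-upTo⁺ j≤q))

∈-standardSeq⁻ : ∀ {p q i j} → (i , j) ∈ standardSeq p q →
  (1 ≤ i × i ≤ p) × (1 ≤ j × j ≤ q)
∈-standardSeq⁻ {suc p} {q} ∈std with ∈-++⁻ (row (suc p) q) ∈std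
... | inj₁ ∈row with refl , j-bounds ← ∈-row⁻ ∈row = (s≤s z≤n , ≤-refl) , j-bounds
... | inj₂ ∈std' with (1≤i , i≤p) , j-bounds ← ∈-standardSeq⁻ {p} ∈std' =
  (1≤i , m≤n⇒m≤1+n i≤p) , j-bounds

∈-standardSeq⁺ : ∀ {p q i j} → 1 ≤ i → i ≤ p → 1 ≤ j → j ≤ q → (i , j) ∈ standardSeq p q
∈-standardSeq⁺ {zero} (s≤s _) ()
∈-standardSeq⁺ {suc p} {q} 1≤i i≤1+p 1≤j j≤q with m≤n⇒m<n∨m≡n i≤1+p
... | inj₂ refl       = ∈-++⁺ˡ (∈-row⁺ 1≤j j≤q)
... | inj₁ (s≤s i≤p) = ∈-++⁺ʳ (row (suc p) q) (∈-standardSeq⁺ 1≤i i≤p 1≤j j≤q)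

row-unique : ∀ i q → Unique (row i q)
row-unique i q = Unique.map⁺ (cong proj₂) (Unique.map⁺ suc-injective (Unique.upTo⁺ q))

standardSeq-unique : ∀ p q → Unique (standardSeq p q)
standardSeq-unique zero    q = []
standardSeq-unique (suc p) q =
  Unique.++⁺ (row-unique (suc p) q) (standardSeq-unique p q) disjoint
  where
  disjoint : Disjoint (row (suc p) q) (standardSeq p q)
  disjoint {_ , _} (∈row , ∈std) with refl , _ ← ∈-row⁻ ∈row =
    <-irrefl refl (proj₂ (proj₁ (∈-standardSeq⁻ {p} ∈std)))

upTo-precedes : ∀ {k l q} → k < l → l < q → Precedes k l (upTo q)
upTo-precedes {k} {l} {suc q} k<l l<1+q rewrite sym (upTo-∷ʳ q) with m<1+n⇒m<n∨m≡n l<1+q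
... | inj₁ l<q  = precedes-++ʳ (q ∷ []) (upTo-precedes k<l l<q)
... | inj₂ refl = precedes-++ (∈-upTo⁺ k<l) (here refl)

row-precedes : ∀ {i q j j'} → 1 ≤ j → j < j' → j' ≤ q → Precedes (i , j) (i , j') (row i q)
row-precedes {i} {j = suc k} {suc l} _ (s≤s k<l) l<q =
  precedes-map (i ,_) (precedes-map suc (upTo-precedes k<l l<q))

standardSeq-precedes-row : ∀ {p q i j j'} → 1 ≤ i → i ≤ p → 1 ≤ j → j < j' → j' ≤ q →
  Precedes (i , j) (i , j') (standardSeq p q)
standardSeq-precedes-row {zero} (s≤s _) ()
standardSeq-precedes-row {suc p} {q} 1≤i i≤1+p 1≤j j<j' j'≤q with m≤n⇒m<n∨m≡n i≤1+p
... | inj₂ refl       = precedes-++ʳ (standardSeq p q) (row-precedes 1≤j j<j' j'≤q)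
... | inj₁ (s≤s i≤p) =
  precedes-++ˡ (row (suc p) q) (standardSeq-precedes-row 1≤i i≤p 1≤j j<j' j'≤q)

standardSeq-precedes-column : ∀ {p q i i' j} → 1 ≤ i → i < i' → i' ≤ p → 1 ≤ j → j ≤ q →
  Precedes (i' , j) (i , j) (standardSeq p q)
standardSeq-precedes-column {zero} _ (s≤s _) ()
standardSeq-precedes-column {suc p} {q} 1≤i i<i' i'≤1+p 1≤j j≤q with m≤n⇒m<n∨m≡n i'≤1+p
... | inj₂ refl =
  precedes-++ (∈-row⁺ 1≤j j≤q) (∈-standardSeq⁺ 1≤i (≤-pred i<i') 1≤j j≤q)
... | inj₁ (s≤s i'≤p) =
  precedes-++ˡ (row (suc p) q) (standardSeq-precedes-column 1≤i i<i' i'≤p 1≤j j≤q)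

viable-respectsDependentOrder : ∀ {p q s} → Viable p q s →
  RespectsDependentOrder (standardSeq p q) s
viable-respectsDependentOrder {p} {q} (_ , rowOrder , _) (i , j) (_ , j') (inj₁ refl) x≺y
  with ∈-standardSeq⁻ {p} {q} (precedes-∈ˡ x≺y) | ∈-standardSeq⁻ {p} {q} (precedes-∈ʳ x≺y)
... | (1≤i , i≤p) , 1≤j , j≤q | _ , 1≤j' , j'≤q with <-cmp j j'
...   | tri< j<j' _ _ = rowOrder i j j' 1≤i i≤p 1≤j j<j' j'≤q
...   | tri≈ _ refl _ = ⊥-elim (precedes-irrefl (standardSeq-unique p q) x≺y)
...   | tri> _ _ j'<j = ⊥-elim (precedes-asym (standardSeq-unique p q) x≺y
                          (standardSeq-precedes-row {p} {q} 1≤i i≤p 1≤j' j'<j j≤q))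
viable-respectsDependentOrder {p} {q} (_ , _ , columnOrder) (i , j) (i' , _) (inj₂ refl) x≺y
  with ∈-standardSeq⁻ {p} {q} (precedes-∈ˡ x≺y) | ∈-standardSeq⁻ {p} {q} (precedes-∈ʳ x≺y)
... | (1≤i , i≤p) , 1≤j , j≤q | (1≤i' , i'≤p) , _ with <-cmp i i'
...   | tri< i<i' _ _ = ⊥-elim (precedes-asym (standardSeq-unique p q) x≺y
                          (standardSeq-precedes-column {p} {q} 1≤i i<i' i'≤p 1≤j j≤q))
...   | tri≈ _ refl _ = ⊥-elim (precedes-irrefl (standardSeq-unique p q) x≺y)
...   | tri> _ _ i'<i = columnOrder j i' i 1≤j j≤q 1≤i' i'<i i≤p

corollary2p15 : (λs μ : List ℕ) (q : ℕ) (T : ℕ → ℕ → ℕ) (s : List (ℕ × ℕ))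
    → StrictPartition λs → StrictPartition μ → μ ⊆ₚ λs
    → IncreasingSkewTableau λs μ q T
    → Viable (sum μ) q s
    → ∀ a b → InShape λs a b
    → plainPart (applySwitches λs s (initialFilling μ T)) a b
      ≡ plainPart (applySwitches λs (standardSeq (sum μ) q) (initialFilling μ T)) a b
corollary2p15 λs μ q T s _ _ _ _ viable@(s↭standard , _) a b _ =
  plainPart-cong (applySwitches-reorder λs (standardSeq-unique (sum μ) q) s↭standard
    (viable-respectsDependentOrder viable) (initialFilling μ T)) a b
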